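{- Let $1\le n \leq 9$. If $G$ is a connected subcubic $n$-vertex graph that is not a $\mathcal{G}_4$-graph, then $\iota(G,C_4)\leq 1$.
   Context: All graphs are finite and simple. A graph is subcubic if its maximum degree is at most $3$. For $D\subseteq V(G)$, $N[D]=\bigcup_{v\in D}(\{v\}\cup N(v))$. A set $D\subseteq V(G)$ is a $C_4$-isolating set of $G$ if $G-N[D]$ contains no subgraph isomorphic to the $4$-cycle $C_4$; $\iota(G,C_4)$ is the minimum size of such a set. $C_4'$ (the diamond) is the graph on $\{1,2,3,4\}$ with edges $12,23,34,41,13$; $\mathcal{G}_4=\{C_4,C_4',K_4\}$, and a $\mathcal{G}_4$-graph is a graph isomorphic to a member of $\mathcal{G}_4$. -}

module Defs where

open import Data.Nat using (ℕ; zero; suc; _≤_)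
open import Data.Fin using (Fin)
open import Data.Bool using (Bool; true; false)
open import Data.List using (List; length)
open import Data.List.Membership.Propositional using (_∈_)
open import Data.Product using (Σ; _×_; _,_; ∃)
open import Data.Sum using (_⊎_)
open import Relation.Binary.PropositionalEquality using (_≡_; _≢_)
open import Relation.Nullary using (¬_)
open import Function.Bundles using (_⤖_; Bijection)

record Graph (n : ℕ) : Set where
  field
    adj   : Fin n → Fin n → Bool
    sym   : ∀ u v → adj u v ≡ adj v u
    irrefl : ∀ v → adj v v ≡ false

open Graph public

Adj : ∀ {n} → Graph n → Fin n → Fin n → Set
Adj G u v = adj G u v ≡ true

Subcubic : ∀ {n} → Graph n → Set
Subcubic {n} G = ∀ (v a b c d : Fin n) →
  Adj G v a → Adj G v b → Adj G v c → Adj G v d →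
  ¬ (a ≢ b × a ≢ c × a ≢ d × b ≢ c × b ≢ d × c ≢ d)

data Reach {n} (G : Graph n) : Fin n → Fin n → Set where
  here : ∀ {v} → Reach G v v
  step : ∀ {u v w} → Adj G u v → Reach G v w → Reach G u w

Connected : ∀ {n} → Graph n → Set
Connected {n} G = ∀ (u v : Fin n) → Reach G u v

InClosedNbhd : ∀ {n} → Graph n → List (Fin n) → Fin n → Set
InClosedNbhd G D x = Σ _ λ v → v ∈ D × (x ≡ v ⊎ Adj G v x)

-- G - N[D] contains a subgraph isomorphic to C4: four distinct vertices
-- outside N[D] with edges ab, bc, cd, da.
HasC4Outside : ∀ {n} → Graph n → List (Fin n) → Set
HasC4Outside {n} G D = Σ (Fin n) λ a → Σ (Fin n) λ b → Σ (Fin n) λ c → Σ (Fin n) λ d →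
  (a ≢ b × a ≢ c × a ≢ d × b ≢ c × b ≢ d × c ≢ d) ×
  (¬ InClosedNbhd G D a × ¬ InClosedNbhd G D b × ¬ InClosedNbhd G D c × ¬ InClosedNbhd G D d) ×
  (Adj G a b × Adj G b c × Adj G c d × Adj G d a)

IsC4IsolatingSet : ∀ {n} → Graph n → List (Fin n) → Set
IsC4IsolatingSet G D = ¬ HasC4Outside G D

-- ι(G, C4) ≤ k : there is a C4-isolating set of size at most k.
-- (A list of length ≤ k gives a set of size ≤ k, and conversely.)
ιC4≤ : ∀ {n} → Graph n → ℕ → Set
ιC4≤ {n} G k = Σ (List (Fin n)) λ D → (length D ≤ k) × IsC4IsolatingSet G D

Iso : ∀ {n m} → Graph n → Graph m → Set
Iso {n} {m} G H = Σ (Fin n ⤖ Fin m) λ f →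
  ∀ u v → adj G u v ≡ adj H (Bijection.to f u) (Bijection.to f v)

-- The graphs C4, C4' (diamond), K4 on Fin 4 = {0,1,2,3}
-- (paper's vertices 1,2,3,4 become 0,1,2,3).
open import Data.Fin.Patterns

c4adj : Fin 4 → Fin 4 → Bool
c4adj 0F 1F = true
c4adj 1F 0F = true
c4adj 1F 2F = true
c4adj 2F 1F = true
c4adj 2F 3F = true
c4adj 3F 2F = true
c4adj 3F 0F = true
c4adj 0F 3F = true
c4adj _ _ = false

diamondAdj : Fin 4 → Fin 4 → Bool
diamondAdj 0F 2F = true
diamondAdj 2F 0F = true
diamondAdj u v = c4adj u v

k4adj : Fin 4 → Fin 4 → Bool
k4adj 0F 0F = false
k4adj 1F 1F = false
k4adj 2F 2F = false
k4adj 3F 3F = false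
k4adj _ _ = true

open import Relation.Binary.PropositionalEquality using (refl)

C4 : Graph 4
C4 = record { adj = c4adj ; sym = s ; irrefl = i }
  where
  s : ∀ u v → c4adj u v ≡ c4adj v u
  s 0F 0F = refl
  s 0F 1F = refl
  s 0F 2F = refl
  s 0F 3F = refl
  s 1F 0F = refl
  s 1F 1F = refl
  s 1F 2F = refl
  s 1F 3F = refl
  s 2F 0F = refl
  s 2F 1F = refl
  s 2F 2F = refl
  s 2F 3F = refl
  s 3F 0F = refl
  s 3F 1F = refl
  s 3F 2F = refl
  s 3F 3F = refl
  i : ∀ v → c4adj v v ≡ false
  i 0F = refl
  i 1F = refl
  i 2F = refl
  i 3F = refl

Diamond : Graph 4
Diamond = record { adj = diamondAdj ; sym = s ; irrefl = i }
  where
  s : ∀ u v → diamondAdj u v ≡ diamondAdj v u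
  s 0F 0F = refl
  s 0F 1F = refl
  s 0F 2F = refl
  s 0F 3F = refl
  s 1F 0F = refl
  s 1F 1F = refl
  s 1F 2F = refl
  s 1F 3F = refl
  s 2F 0F = refl
  s 2F 1F = refl
  s 2F 2F = refl
  s 2F 3F = refl
  s 3F 0F = refl
  s 3F 1F = refl
  s 3F 2F = refl
  s 3F 3F = refl
  i : ∀ v → diamondAdj v v ≡ false
  i 0F = refl
  i 1F = refl
  i 2F = refl
  i 3F = refl

K4 : Graph 4
K4 = record { adj = k4adj ; sym = s ; irrefl = i }
  where
  s : ∀ u v → k4adj u v ≡ k4adj v u
  s 0F 0F = refl
  s 0F 1F = refl
  s 0F 2F = refl
  s 0F 3F = refl
  s 1F 0F = refl
  s 1F 1F = refl
  s 1F 2F = refl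
  s 1F 3F = refl
  s 2F 0F = refl
  s 2F 1F = refl
  s 2F 2F = refl
  s 2F 3F = refl
  s 3F 0F = refl
  s 3F 1F = refl
  s 3F 2F = refl
  s 3F 3F = refl
  i : ∀ v → k4adj v v ≡ false
  i 0F = refl
  i 1F = refl
  i 2F = refl
  i 3F = refl

IsG4Graph : ∀ {n} → Graph n → Set
IsG4Graph G = Iso G C4 ⊎ Iso G Diamond ⊎ Iso G K4

{-# OPTIONS --safe #-}
module Submission where

-- Suppose no single vertex isolates all 4-cycles, so for every vertex v some
-- 4-cycle avoids N[v].  Take such a cycle Q₁ and a cycle Q₂ avoiding N[x] for a
-- corner x of Q₁.  They are disjoint: the corner of Q₁ opposite x would
-- otherwise have its two Q₁-neighbours and two Q₂-neighbours.  As n ≤ 9, at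
-- most one vertex lies off Q₁ ∪ Q₂.  If an edge xy joins Q₁ to Q₂, the cycle
-- avoiding N[x] is disjoint from Q₁, misses y, and so cannot lie inside Q₂; it
-- therefore passes through the off vertex, whose two cycle-neighbours must lie
-- on Q₂.  By symmetry that vertex also has two neighbours on Q₁: four in all.
-- If no edge joins them, connectivity makes the off vertex w adjacent to both
-- cycles; a cycle avoiding N[w] lies in Q₁ ∪ Q₂, hence inside one of them, hence
-- is that cycle — yet it must miss w's neighbour there.

open import Defs hiding (sym; irrefl)
open import Data.Nat using (ℕ; _≤_; zero; suc; s≤s; z≤n)
open import Data.Nat.Properties using (≤-trans; 1+n≰n)
open import Data.Fin using (Fin; zero; suc; punchOut)
open import Data.Fin.Patterns using (0F; 1F; 2F; 3F)
open import Data.Fin.Properties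
  using (_≟_; any?; all?; ¬∀⟶∃¬; injective⇒≤; punchOut-injective; +↔⊎)
open import Data.Bool using (true)
import Data.Bool.Properties as Bool
open import Data.List using (List; [_])
open import Data.List.Relation.Unary.Any using (here)
open import Data.Vec.Functional using (Vector; []; _∷_; _++_)
open import Data.Vec.Functional.Relation.Unary.All using (All)
open import Data.Vec.Functional.Relation.Unary.All.Properties using (++⁺)
open import Data.Product using (Σ; ∃; ∃₂; _×_; _,_; proj₁; proj₂; swap)
open import Data.Sum as Sum using (_⊎_; inj₁; inj₂; [_,_]′)
open import Data.Empty using (⊥; ⊥-elim)
open import Function using (_∘_; Injection)
open import Function.Definitions using (Injective)
open import Function.Properties.Inverse using (↔⇒↣)
open import Relation.Nullary using (¬_; Dec; yes; no; ¬?; contradiction)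
open import Relation.Nullary.Decidable using (_×-dec_; _⊎-dec_; map′; decidable-stable; toWitness)
open import Relation.Unary using (Pred; Decidable)
open import Relation.Binary.PropositionalEquality
  using (_≡_; _≢_; refl; sym; trans; cong; subst)

module _ {a} {A : Set a} where

  []-injective : Injective _≡_ _≡_ ([] {A = A})
  []-injective {()}

  ∷-injective : ∀ {m} {x : A} {xs : Vector A m} →
                All (x ≢_) xs → Injective _≡_ _≡_ xs → Injective _≡_ _≡_ (x ∷ xs)
  ∷-injective x∉xs xs-inj {zero}  {zero}  _  = refl
  ∷-injective x∉xs xs-inj {zero}  {suc j} eq = contradiction eq (x∉xs j)
  ∷-injective x∉xs xs-inj {suc i} {zero}  eq = contradiction (sym eq) (x∉xs i)
  ∷-injective x∉xs xs-inj {suc i} {suc j} eq = cong suc (xs-inj eq)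

  [,]-injective : ∀ {b c} {B : Set b} {C : Set c} {f : B → A} {g : C → A} →
                  Injective _≡_ _≡_ f → Injective _≡_ _≡_ g → (∀ x y → f x ≢ g y) →
                  Injective _≡_ _≡_ [ f , g ]′
  [,]-injective f-inj g-inj f≢g {inj₁ x} {inj₁ x′} eq = cong inj₁ (f-inj eq)
  [,]-injective f-inj g-inj f≢g {inj₁ x} {inj₂ y}  eq = contradiction eq (f≢g x y)
  [,]-injective f-inj g-inj f≢g {inj₂ y} {inj₁ x}  eq = contradiction (sym eq) (f≢g x y)
  [,]-injective f-inj g-inj f≢g {inj₂ y} {inj₂ y′} eq = cong inj₂ (g-inj eq)

  ++-injective : ∀ {m k} {xs : Vector A m} {ys : Vector A k} →
                 Injective _≡_ _≡_ xs → Injective _≡_ _≡_ ys → All (λ y → All (_≢ y) xs) ys →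
                 Injective _≡_ _≡_ (xs ++ ys)
  ++-injective {m} xs-inj ys-inj disjoint eq =
    Injection.injective (↔⇒↣ (+↔⊎ {m})) ([,]-injective xs-inj ys-inj (λ i j → disjoint j i) eq)

injective⇒surjective : ∀ {m} {f : Fin m → Fin m} → Injective _≡_ _≡_ f → ∀ j → ∃ λ i → f i ≡ j
injective⇒surjective {suc m} {f} f-inj j with any? (λ i → f i ≟ j)
... | yes hit  = hit
... | no  miss = contradiction (injective⇒≤ punchOut-f-injective) 1+n≰n
  where
  j≢f : ∀ i → j ≢ f i
  j≢f i eq = miss (i , sym eq)

  punchOut-f-injective : Injective _≡_ _≡_ (λ i → punchOut (j≢f i))
  punchOut-f-injective eq = f-inj (punchOut-injective (j≢f _) (j≢f _) eq)

next : Fin 4 → Fin 4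
next 0F = 1F
next 1F = 2F
next 2F = 3F
next 3F = 0F

prev : Fin 4 → Fin 4
prev i = next (next (next i))

next-prev : ∀ i → next (prev i) ≡ i
next-prev 0F = refl
next-prev 1F = refl
next-prev 2F = refl
next-prev 3F = refl

next≢prev : ∀ i → next i ≢ prev i
next≢prev 0F ()
next≢prev 1F ()
next≢prev 2F ()
next≢prev 3F ()

cyclic-cover : ∀ i j → j ≡ i ⊎ j ≡ next i ⊎ j ≡ next (next i) ⊎ j ≡ prev i
cyclic-cover = toWitness {a? = all? λ i → all? λ j →
  (j ≟ i) ⊎-dec (j ≟ next i) ⊎-dec (j ≟ next (next i)) ⊎-dec (j ≟ prev i)} _

module _ {n} (G : Graph n) where

  open import Data.List.Membership.DecPropositional (_≟_ {n}) using (_∈?_)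

  Adj-sym : ∀ {u v} → Adj G u v → Adj G v u
  Adj-sym {u} {v} e = trans (Graph.sym G v u) e

  Adj⇒≢ : ∀ {u v} → Adj G u v → u ≢ v
  Adj⇒≢ {u} e refl with () ← trans (sym e) (Graph.irrefl G u)

  record Square : Set where
    field
      corner           : Vector (Fin n) 4
      corner-injective : Injective _≡_ _≡_ corner
      corner-adj       : ∀ i → Adj G (corner i) (corner (next i))

  open Square public

  corner-adj-prev : ∀ Q i → Adj G (corner Q i) (corner Q (prev i))
  corner-adj-prev Q i =
    Adj-sym (subst (Adj G (corner Q (prev i)) ∘ corner Q) (next-prev i) (corner-adj Q (prev i)))

  infix 4 _∈□_ _∉□_ _∈□?_ _⊆□_

  record _∈□_ (v : Fin n) (Q : Square) : Set where
    constructor at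
    field
      position  : Fin 4
      is-corner : v ≡ corner Q position

  _∉□_ : Fin n → Square → Set
  v ∉□ Q = ¬ v ∈□ Q

  _∈□?_ : ∀ v Q → Dec (v ∈□ Q)
  v ∈□? Q = map′ (λ (i , eq) → at i eq) (λ (at i eq) → i , eq) (any? λ i → v ≟ corner Q i)

  ∉□⇒All≢ : ∀ {v Q} → v ∉□ Q → All (v ≢_) (corner Q)
  ∉□⇒All≢ v∉Q i eq = v∉Q (at i eq)

  _⊆□_ : Square → Square → Set
  Q′ ⊆□ Q = ∀ {v} → v ∈□ Q′ → v ∈□ Q

  ⊆□⇒⊇□ : ∀ {Q′ Q} → Q′ ⊆□ Q → Q ⊆□ Q′
  ⊆□⇒⊇□ {Q′} {Q} Q′⊆Q (at j refl) =
    let i , σi≡j = injective⇒surjective σ-injective j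
    in at i (trans (cong (corner Q) (sym σi≡j)) (sym (σ-spec i)))
    where
    σ : Fin 4 → Fin 4
    σ i = _∈□_.position (Q′⊆Q (at i refl))

    σ-spec : ∀ i → corner Q′ i ≡ corner Q (σ i)
    σ-spec i = _∈□_.is-corner (Q′⊆Q (at i refl))

    σ-injective : Injective _≡_ _≡_ σ
    σ-injective {i} {i′} eq =
      corner-injective Q′ (trans (σ-spec i) (trans (cong (corner Q) eq) (sym (σ-spec i′))))

  Disjoint : Square → Square → Set
  Disjoint Q₁ Q₂ = ∀ {v} → v ∈□ Q₁ → v ∉□ Q₂

  Disjoint-sym : ∀ {Q₁ Q₂} → Disjoint Q₁ Q₂ → Disjoint Q₂ Q₁
  Disjoint-sym disjoint v∈Q₂ v∈Q₁ = disjoint v∈Q₁ v∈Q₂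

  Disjoint⇒≢ : ∀ {Q₁ Q₂ u v} → Disjoint Q₁ Q₂ → u ∈□ Q₁ → v ∈□ Q₂ → u ≢ v
  Disjoint⇒≢ disjoint u∈Q₁ v∈Q₂ refl = disjoint u∈Q₁ v∈Q₂

  Off : Square → Square → Fin n → Set
  Off Q₁ Q₂ v = v ∉□ Q₁ × v ∉□ Q₂

  record EdgeBetween (Q₁ Q₂ : Square) : Set where
    constructor edge
    field
      from to  : Fin 4
      adjacent : Adj G (corner Q₁ from) (corner Q₂ to)

  edgeBetween? : ∀ Q₁ Q₂ → Dec (EdgeBetween Q₁ Q₂)
  edgeBetween? Q₁ Q₂ = map′ (λ (i , j , e) → edge i j e) (λ (edge i j e) → i , j , e)
    (any? λ i → any? λ j → adj G (corner Q₁ i) (corner Q₂ j) Bool.≟ true)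

  ¬EdgeBetween-sym : ∀ {Q₁ Q₂} → ¬ EdgeBetween Q₁ Q₂ → ¬ EdgeBetween Q₂ Q₁
  ¬EdgeBetween-sym no-edge (edge i j e) = no-edge (edge j i (Adj-sym e))

  ¬EdgeBetween⇒¬Adj : ∀ {Q₁ Q₂ x y} → ¬ EdgeBetween Q₁ Q₂ → x ∈□ Q₁ → y ∈□ Q₂ → ¬ Adj G x y
  ¬EdgeBetween⇒¬Adj no-edge (at i refl) (at j refl) e = no-edge (edge i j e)

  corner-closed : ∀ {ℓ} (P : Pred (Fin n) ℓ) (Q : Square) →
                  (∀ i → P (corner Q i) → P (corner Q (next i))) →
                  ∀ {k} → P (corner Q k) → ∀ j → P (corner Q j)
  corner-closed P Q advance {k} pk j with cyclic-cover k j
  ... | inj₁ refl                = pk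
  ... | inj₂ (inj₁ refl)         = advance k pk
  ... | inj₂ (inj₂ (inj₁ refl))  = advance _ (advance k pk)
  ... | inj₂ (inj₂ (inj₂ refl))  = advance _ (advance _ (advance k pk))

  trapped : ∀ {Q₁ Q₂ Q} → ¬ EdgeBetween Q₁ Q₂ → (∀ i → corner Q i ∈□ Q₁ ⊎ corner Q i ∈□ Q₂) →
            ∀ {k} → corner Q k ∈□ Q₁ → Q ⊆□ Q₁
  trapped {Q₁} {Q₂} {Q} no-edge cover k∈Q₁ (at j refl) = corner-closed (_∈□ Q₁) Q stays k∈Q₁ j
    where
    stays : ∀ i → corner Q i ∈□ Q₁ → corner Q (next i) ∈□ Q₁
    stays i i∈Q₁ with cover (next i)
    ... | inj₁ next∈Q₁ = next∈Q₁
    ... | inj₂ next∈Q₂ = contradiction (corner-adj Q i) (¬EdgeBetween⇒¬Adj no-edge i∈Q₁ next∈Q₂)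

  Avoids : List (Fin n) → Square → Set
  Avoids D Q = ∀ {v} → v ∈□ Q → ¬ InClosedNbhd G D v

  avoids-self : ∀ {v Q} → Avoids [ v ] Q → v ∉□ Q
  avoids-self {v} avoids v∈Q = avoids v∈Q (v , here refl , inj₁ refl)

  avoids-neighbour : ∀ {v u Q} → Avoids [ v ] Q → Adj G v u → u ∉□ Q
  avoids-neighbour {v} avoids v-u u∈Q = avoids u∈Q (v , here refl , inj₂ v-u)

  square-outside : ∀ {D} → HasC4Outside G D → Σ Square (Avoids D)
  square-outside (a , b , c , d , (a≢b , a≢c , a≢d , b≢c , b≢d , c≢d) ,
                  (a∉ , b∉ , c∉ , d∉) , (a-b , b-c , c-d , d-a)) = Q , avoids
    where
    Q : Square
    Q = record
      { corner           = a ∷ b ∷ c ∷ d ∷ []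
      ; corner-injective = ∷-injective (λ { 0F → a≢b ; 1F → a≢c ; 2F → a≢d })
                          (∷-injective (λ { 0F → b≢c ; 1F → b≢d })
                          (∷-injective (λ { 0F → c≢d })
                          (∷-injective (λ ()) []-injective)))
      ; corner-adj       = λ { 0F → a-b ; 1F → b-c ; 2F → c-d ; 3F → d-a }
      }

    avoids : Avoids _ Q
    avoids (at 0F refl) = a∉
    avoids (at 1F refl) = b∉
    avoids (at 2F refl) = c∉
    avoids (at 3F refl) = d∉

  closedNbhd? : ∀ D v → Dec (InClosedNbhd G D v)
  closedNbhd? D v = any? λ u → (u ∈? D) ×-dec ((v ≟ u) ⊎-dec (adj G u v Bool.≟ true))

  hasC4Outside? : ∀ D → Dec (HasC4Outside G D)
  hasC4Outside? D = any? λ a → any? λ b → any? λ c → any? λ d →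
    (a ≢? b ×-dec a ≢? c ×-dec a ≢? d ×-dec b ≢? c ×-dec b ≢? d ×-dec c ≢? d) ×-dec
    (outside? a ×-dec outside? b ×-dec outside? c ×-dec outside? d) ×-dec
    (adj? a b ×-dec adj? b c ×-dec adj? c d ×-dec adj? d a)
    where
    _≢?_ : ∀ u v → Dec (u ≢ v)
    u ≢? v = ¬? (u ≟ v)

    outside? : ∀ v → Dec (¬ InClosedNbhd G D v)
    outside? v = ¬? (closedNbhd? D v)

    adj? : ∀ u v → Dec (Adj G u v)
    adj? u v = adj G u v Bool.≟ true

  Reach⇒leaving-edge : ∀ {ℓ} {P : Pred (Fin n) ℓ} → Decidable P → ∀ {u v} → Reach G u v →
                       P u → ¬ P v → ∃₂ λ x y → P x × ¬ P y × Adj G x y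
  Reach⇒leaving-edge P? here                pu ¬pw = contradiction pu ¬pw
  Reach⇒leaving-edge P? (step {v = v} e walk) pu ¬pw with P? v
  ... | yes pv  = Reach⇒leaving-edge P? walk pv ¬pw
  ... | no  ¬pv = _ , v , pu , ¬pv , e

  module _ (connected : Connected G) where

    exit-to-off : ∀ {Q₁ Q₂} → Disjoint Q₁ Q₂ → ¬ EdgeBetween Q₁ Q₂ →
                  ∃₂ λ x w → x ∈□ Q₁ × Off Q₁ Q₂ w × Adj G x w
    exit-to-off {Q₁} {Q₂} disjoint no-edge =
      let x , w , x∈Q₁ , w∉Q₁ , x-w = Reach⇒leaving-edge (_∈□? Q₁)
            (connected (corner Q₁ 0F) (corner Q₂ 0F))
            (at 0F refl) (Disjoint-sym disjoint (at 0F refl))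
      in x , w , x∈Q₁ , (w∉Q₁ , λ w∈Q₂ → ¬EdgeBetween⇒¬Adj no-edge x∈Q₁ w∈Q₂ x-w) , x-w

  ten-vertices-injective : ∀ {Q₁ Q₂ u w} → Disjoint Q₁ Q₂ → Off Q₁ Q₂ u → Off Q₁ Q₂ w → u ≢ w →
                  Injective _≡_ _≡_ (u ∷ w ∷ (corner Q₁ ++ corner Q₂))
  ten-vertices-injective {Q₁} {Q₂} {u} {w} disjoint (u∉Q₁ , u∉Q₂) (w∉Q₁ , w∉Q₂) u≢w =
    ∷-injective (λ { zero → u≢w ; (suc i) → ++⁺ (u ≢_) (∉□⇒All≢ u∉Q₁) (∉□⇒All≢ u∉Q₂) i })
    (∷-injective (++⁺ (w ≢_) (∉□⇒All≢ w∉Q₁) (∉□⇒All≢ w∉Q₂))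
    (++-injective (corner-injective Q₁) (corner-injective Q₂)
      (λ j i → Disjoint⇒≢ disjoint (at i refl) (at j refl))))

  module _ (n≤9 : n ≤ 9) where

    off-unique : ∀ {Q₁ Q₂ u w} → Disjoint Q₁ Q₂ → Off Q₁ Q₂ u → Off Q₁ Q₂ w → u ≡ w
    off-unique {u = u} {w} disjoint u-off w-off with u ≟ w
    ... | yes u≡w = u≡w
    ... | no  u≢w =
      let 10≤n = injective⇒≤ (ten-vertices-injective disjoint u-off w-off u≢w)
      in contradiction (≤-trans 10≤n n≤9) 1+n≰n

    covered : ∀ {Q₁ Q₂ w v} → Disjoint Q₁ Q₂ → Off Q₁ Q₂ w → v ≢ w → v ∈□ Q₁ ⊎ v ∈□ Q₂
    covered {Q₁} {Q₂} {w} {v} disjoint w-off v≢w with v ∈□? Q₁ | v ∈□? Q₂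
    ... | yes v∈Q₁ | _        = inj₁ v∈Q₁
    ... | no _     | yes v∈Q₂ = inj₂ v∈Q₂
    ... | no v∉Q₁  | no v∉Q₂  = contradiction (off-unique disjoint (v∉Q₁ , v∉Q₂) w-off) v≢w

  TwoNeighboursOn : Square → Fin n → Set
  TwoNeighboursOn Q w = ∃₂ λ s t → s ≢ t × s ∈□ Q × t ∈□ Q × Adj G w s × Adj G w t

  module _ (subcubic : Subcubic G) where

    two-neighbours-off⇒∉□ : ∀ {Q z u₁ u₂} → Adj G z u₁ → Adj G z u₂ → u₁ ≢ u₂ →
                            u₁ ∉□ Q → u₂ ∉□ Q → z ∉□ Q
    two-neighbours-off⇒∉□ {Q} z-u₁ z-u₂ u₁≢u₂ u₁∉Q u₂∉Q (at i refl) =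
      subcubic _ _ _ _ _ z-u₁ z-u₂ (corner-adj Q i) (corner-adj-prev Q i)
        ( u₁≢u₂ , ∉□⇒All≢ u₁∉Q (next i) , ∉□⇒All≢ u₁∉Q (prev i)
        , ∉□⇒All≢ u₂∉Q (next i) , ∉□⇒All≢ u₂∉Q (prev i)
        , next≢prev i ∘ corner-injective Q )

    avoiding-corner⇒disjoint : ∀ {Q₁ Q v} → v ∈□ Q₁ → Avoids [ v ] Q → Disjoint Q₁ Q
    avoiding-corner⇒disjoint {Q₁} {Q} (at i refl) avoids (at j refl) = corner∉ (cyclic-cover i j)
      where
      next∉ : corner Q₁ (next i) ∉□ Q
      next∉ = avoids-neighbour avoids (corner-adj Q₁ i)

      prev∉ : corner Q₁ (prev i) ∉□ Q
      prev∉ = avoids-neighbour avoids (corner-adj-prev Q₁ i)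

      corner∉ : ∀ {j} → j ≡ i ⊎ j ≡ next i ⊎ j ≡ next (next i) ⊎ j ≡ prev i → corner Q₁ j ∉□ Q
      corner∉ (inj₁ refl)               = avoids-self avoids
      corner∉ (inj₂ (inj₁ refl))        = next∉
      corner∉ (inj₂ (inj₂ (inj₁ refl))) =
        two-neighbours-off⇒∉□ (Adj-sym (corner-adj Q₁ (next i))) (corner-adj Q₁ (next (next i)))
          (next≢prev i ∘ corner-injective Q₁) next∉ prev∉
      corner∉ (inj₂ (inj₂ (inj₂ refl))) = prev∉

    two-neighbours-on-both⇒⊥ : n ≤ 9 → ∀ {Q₁ Q₂ w w′} → Disjoint Q₁ Q₂ →
                               Off Q₁ Q₂ w → TwoNeighboursOn Q₂ w →
                               Off Q₁ Q₂ w′ → TwoNeighboursOn Q₁ w′ → ⊥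
    two-neighbours-on-both⇒⊥ n≤9 {Q₁} {Q₂} disjoint
      w-off  (s  , t  , s≢t   , s∈Q₂  , t∈Q₂  , w-s   , w-t)
      w′-off (s′ , t′ , s′≢t′ , s′∈Q₁ , t′∈Q₁ , w′-s′ , w′-t′)
      with off-unique n≤9 disjoint w-off w′-off
    ... | refl = subcubic _ s t s′ t′ w-s w-t w′-s′ w′-t′
                   ( s≢t , apart s∈Q₂ s′∈Q₁ , apart s∈Q₂ t′∈Q₁
                   , apart t∈Q₂ s′∈Q₁ , apart t∈Q₂ t′∈Q₁ , s′≢t′ )
      where
      apart : ∀ {u v} → u ∈□ Q₂ → v ∈□ Q₁ → u ≢ v
      apart = Disjoint⇒≢ (Disjoint-sym disjoint)

    module _ (n≤9 : n ≤ 9) (connected : Connected G)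
             (avoider : ∀ v → Σ Square (Avoids [ v ])) where

      avoiding : Fin n → Square
      avoiding v = proj₁ (avoider v)

      avoiding-avoids : ∀ v → Avoids [ v ] (avoiding v)
      avoiding-avoids v = proj₂ (avoider v)

      attached-vertex : ∀ {Q₁ Q₂ x y} → Disjoint Q₁ Q₂ → x ∈□ Q₁ → y ∈□ Q₂ → Adj G x y →
                        ∃ λ w → Off Q₁ Q₂ w × TwoNeighboursOn Q₂ w
      attached-vertex {Q₁} {Q₂} {x} disjoint x∈Q₁ y∈Q₂ x-y =
        z , z-off , _ , _ , next≢prev k ∘ corner-injective Q ,
        on-Q₂ (next k) (corner-adj Q k) , on-Q₂ (prev k) (corner-adj-prev Q k) ,
        corner-adj Q k , corner-adj-prev Q k
        where
        Q : Square
        Q = avoiding x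

        Q₁-Q-disjoint : Disjoint Q₁ Q
        Q₁-Q-disjoint = avoiding-corner⇒disjoint x∈Q₁ (avoiding-avoids x)

        Q⊈Q₂ : ¬ (∀ k → corner Q k ∈□ Q₂)
        Q⊈Q₂ Q⊆Q₂ =
          avoids-neighbour (avoiding-avoids x) x-y (⊆□⇒⊇□ (λ { (at k refl) → Q⊆Q₂ k }) y∈Q₂)

        off-Q₂ : ∃ λ k → corner Q k ∉□ Q₂
        off-Q₂ = ¬∀⟶∃¬ 4 (λ k → corner Q k ∈□ Q₂) (λ k → corner Q k ∈□? Q₂) Q⊈Q₂

        k : Fin 4
        k = proj₁ off-Q₂

        z : Fin n
        z = corner Q k

        z-off : Off Q₁ Q₂ z
        z-off = (λ z∈Q₁ → Q₁-Q-disjoint z∈Q₁ (at k refl)) , proj₂ off-Q₂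

        on-Q₂ : ∀ i → Adj G z (corner Q i) → corner Q i ∈□ Q₂
        on-Q₂ i z-i with covered n≤9 disjoint z-off (Adj⇒≢ (Adj-sym z-i))
        ... | inj₁ i∈Q₁ = contradiction (at i refl) (Q₁-Q-disjoint i∈Q₁)
        ... | inj₂ i∈Q₂ = i∈Q₂

      no-edge-between : ∀ {Q₁ Q₂} → Disjoint Q₁ Q₂ → ¬ EdgeBetween Q₁ Q₂
      no-edge-between disjoint (edge i j e) =
        let w  , w-off  , w-neighbours  = attached-vertex disjoint (at i refl) (at j refl) e
            w′ , w′-off , w′-neighbours =
              attached-vertex (Disjoint-sym disjoint) (at j refl) (at i refl) (Adj-sym e)
        in two-neighbours-on-both⇒⊥ n≤9 disjoint w-off w-neighbours (swap w′-off) w′-neighbours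

      no-bridge : ∀ {Q₁ Q₂ w x y} → Disjoint Q₁ Q₂ → ¬ EdgeBetween Q₁ Q₂ → Off Q₁ Q₂ w →
                  x ∈□ Q₁ → y ∈□ Q₂ → Adj G w x → Adj G w y → ⊥
      no-bridge {Q₁} {Q₂} {w} disjoint no-edge w-off x∈Q₁ y∈Q₂ w-x w-y =
        [ trapped-in-Q₁ , trapped-in-Q₂ ]′ (cover 0F)
        where
        Q : Square
        Q = avoiding w

        cover : ∀ i → corner Q i ∈□ Q₁ ⊎ corner Q i ∈□ Q₂
        cover i =
          covered n≤9 disjoint w-off (λ eq → avoids-self (avoiding-avoids w) (at i (sym eq)))

        trapped-in-Q₁ : corner Q 0F ∈□ Q₁ → ⊥
        trapped-in-Q₁ 0∈Q₁ =
          avoids-neighbour (avoiding-avoids w) w-x (⊆□⇒⊇□ (trapped no-edge cover 0∈Q₁) x∈Q₁)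

        trapped-in-Q₂ : corner Q 0F ∈□ Q₂ → ⊥
        trapped-in-Q₂ 0∈Q₂ =
          avoids-neighbour (avoiding-avoids w) w-y
            (⊆□⇒⊇□ (trapped (¬EdgeBetween-sym no-edge) (Sum.swap ∘ cover) 0∈Q₂) y∈Q₂)

      edge-between : ∀ {Q₁ Q₂} → Disjoint Q₁ Q₂ → EdgeBetween Q₁ Q₂
      edge-between {Q₁} {Q₂} disjoint with edgeBetween? Q₁ Q₂
      ... | yes found = found
      ... | no no-edge
        with exit-to-off connected disjoint no-edge
           | exit-to-off connected (Disjoint-sym disjoint) (¬EdgeBetween-sym no-edge)
      ... | x , w , x∈Q₁ , w-off , x-w | y , w′ , y∈Q₂ , w′-off , y-w′
        with off-unique n≤9 disjoint w-off (swap w′-off)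
      ... | refl =
        ⊥-elim (no-bridge disjoint no-edge w-off x∈Q₁ y∈Q₂ (Adj-sym x-w) (Adj-sym y-w′))

      no-vertex : ¬ Fin n
      no-vertex v = no-edge-between disjoint (edge-between disjoint)
        where
        disjoint : Disjoint (avoiding v) (avoiding (corner (avoiding v) 0F))
        disjoint = avoiding-corner⇒disjoint (at 0F refl) (avoiding-avoids _)

isolating-vertex : ∀ {n} (G : Graph n) → Subcubic G → n ≤ 9 → Connected G →
                   Fin n → ∃ λ v → IsC4IsolatingSet G [ v ]
isolating-vertex G subcubic n≤9 connected v₀ with any? (λ v → ¬? (hasC4Outside? G [ v ]))
... | yes isolating = isolating
... | no  none      = ⊥-elim (no-vertex G subcubic n≤9 connected avoider v₀)
  where
  avoider : ∀ v → Σ (Square G) (Avoids G [ v ])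
  avoider v = square-outside G (decidable-stable (hasC4Outside? G [ v ]) (none ∘ (v ,_)))

lemma4 : (n : ℕ) → 1 ≤ n → n ≤ 9 → (G : Graph n) →
    Connected G → Subcubic G → ¬ IsG4Graph G → ιC4≤ G 1
lemma4 (suc _) _ n≤9 G connected subcubic _ =
  let v , isolating = isolating-vertex G subcubic n≤9 connected zero
  in [ v ] , s≤s z≤n , isolating
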